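{- Let $\Phi^+$ be the set of positive roots of $G_2$, with short simple root $\alpha_s$ and long simple root $\alpha_l$, so $\Phi^+=\{i\alpha_s+j\alpha_l : (i,j)\in\{(1,0),(0,1),(1,1),(2,1),(3,1),(3,2)\}\}$. Let $\mathcal{P}$ be the set of integer tuples $(a,b,c,d,e,f)\in\mathbb{Z}^6$ satisfying $2a\ge 2b\ge c\ge 2d\ge 2e\ge 0$ and $f\ge 0$, and let $\mathcal{V}$ be the set of vector partitions, i.e. functions $\xi\colon\Phi^+\to\mathbb{Z}_{\ge 0}$. Then there is a bijection $\mathcal{P}\to\mathcal{V}$, $\pi\mapsto\xi$, such that for $\pi=(a,b,c,d,e,f)$ one has $$\sum_{\alpha\in\Phi^+}\xi(\alpha)\,\alpha=(a+c+e)\,\alpha_s+(b+d+f)\,\alpha_l .$$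
   Context: The elements of $\mathcal{P}$ are the $G_2$ Littelmann patterns $[a,b,c,d,e][f]$ for the reduced word $w_0=s_2s_1s_2s_1s_2s_1$ satisfying the circling inequalities; the monomial of such a pattern is $\mathbf{x}^{\pi}=\mathbf{x}^{(a+c+e)\alpha_s+(b+d+f)\alpha_l}$, and that of a vector partition is $\mathbf{x}^{\xi}=\mathbf{x}^{\sum\xi(\alpha)\alpha}$, so the conclusion says $\mathbf{x}^{\pi}=\mathbf{x}^{\xi}$. -}

module Defs where

open import Data.Nat using (ℕ)
open import Data.Integer using (ℤ; _+_; _*_; _≤_; +_; 0ℤ)
open import Data.Fin using (Fin; zero; suc)
open import Data.Product using (_×_; _,_; Σ)
open import Data.List using (List; []; _∷_; foldr; map)
open import Data.Fin using () renaming (Fin to F)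

PosRoot : Set
PosRoot = Fin 6

-- coordinates (i , j) meaning i α_s + j α_l
root : PosRoot → ℕ × ℕ
root zero = 1 , 0
root (suc zero) = 0 , 1
root (suc (suc zero)) = 1 , 1
root (suc (suc (suc zero))) = 2 , 1
root (suc (suc (suc (suc zero)))) = 3 , 1
root (suc (suc (suc (suc (suc zero))))) = 3 , 2

record Pattern : Set where
  constructor pat
  field
    a b c d e f : ℤ
    h₁ : + 2 * b ≤ + 2 * a
    h₂ : c ≤ + 2 * b
    h₃ : + 2 * d ≤ c
    h₄ : + 2 * e ≤ + 2 * d
    h₅ : 0ℤ ≤ + 2 * e
    h₆ : 0ℤ ≤ f

VectorPartition : Set
VectorPartition = PosRoot → ℕ

allRoots : List PosRoot
allRoots = zero ∷ suc zero ∷ suc (suc zero) ∷ suc (suc (suc zero))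
  ∷ suc (suc (suc (suc zero))) ∷ suc (suc (suc (suc (suc zero)))) ∷ []

weightV : VectorPartition → ℤ × ℤ
weightV ξ = foldr (λ α acc → term α acc) (0ℤ , 0ℤ) allRoots
  where
  term : PosRoot → ℤ × ℤ → ℤ × ℤ
  term α (x , y) with root α
  ... | (i , j) = (+ ξ α * + i + x , + ξ α * + j + y)

weightP : Pattern → ℤ × ℤ
weightP π = (a + c + e , b + d + f)
  where open Pattern π

-- A pattern [a,b,c,d,e][f] is determined by its gaps e, d − e, c − 2d, b − d, a − b, f, which are
-- arbitrary naturals except that c − 2d ≤ 2(b − d).  Writing c − 2d = ρ + 2h with ρ ∈ {0,1}, the
-- gaps become root multiplicities: α_s ↦ a − b, α_l ↦ f, 3α_s + 2α_l ↦ d − e, 3α_s + α_l ↦ h,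
-- 2α_s + α_l ↦ ρ + 2e and α_s + α_l ↦ (b − d) − h − ρ.  Each step is invertible, and the weight
-- identity is linear once the multiplicity of 2α_s + α_l is split into ρ + 2e.

module Submission where

open import Defs
open import Data.Nat using (ℕ)
open import Data.Product using (Σ; _×_)
open import Function.Bundles using (Bijection)
open import Relation.Binary.PropositionalEquality using (_≡_; setoid; _→-setoid_)

open import Data.Nat as ℕ using (z≤n; s≤s; _∸_; _/_; _%_; NonZero)
open import Data.Fin using (zero; suc)
import Data.Nat.Properties as ℕ
open import Data.Nat.DivMod using (m≡m%n+[m/n]*n; m%n<n; m<n⇒m%n≡m; m<n⇒m/n≡0; [m+kn]%n≡m%n; m*n%n≡0; m*n/n≡m; +-distrib-/)
import Data.Nat.Tactic.RingSolver as ℕ-Solver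
open import Data.Integer as ℤ using (ℤ; +_; ∣_∣; +≤+; 0ℤ; _+_; _-_; _*_; _≤_)
import Data.Integer.Properties as ℤ
import Data.Integer.Tactic.RingSolver as ℤ-Solver
open import Data.Product using (_,_)
open import Function.Bundles using (Inverse; _↔_; mk↔ₛ′)
open import Function.Construct.Composition using (inverse)
open import Function.Properties.Inverse using (Inverse⇒Bijection)
open import Relation.Binary.PropositionalEquality using (refl; sym; trans; cong; cong₂; subst; subst₂; module ≡-Reasoning)

[m+kn]%n≡m : ∀ {m} k n .{{_ : NonZero n}} → m ℕ.< n → (m ℕ.+ k ℕ.* n) % n ≡ m
[m+kn]%n≡m {m} k n m<n = trans ([m+kn]%n≡m%n m k n) (m<n⇒m%n≡m m<n)

[m+kn]/n≡k : ∀ {m} k n .{{_ : NonZero n}} → m ℕ.< n → (m ℕ.+ k ℕ.* n) / n ≡ k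
[m+kn]/n≡k {m} k n m<n = begin
  (m ℕ.+ k ℕ.* n) / n   ≡⟨ +-distrib-/ m (k ℕ.* n) remainders<n ⟩
  m / n ℕ.+ k ℕ.* n / n ≡⟨ cong₂ ℕ._+_ (m<n⇒m/n≡0 m<n) (m*n/n≡m k n) ⟩
  k                     ∎
  where
  open ≡-Reasoning
  remainders<n : m % n ℕ.+ k ℕ.* n % n ℕ.< n
  remainders<n = subst (ℕ._< n) (sym remainders≡m) m<n
    where
    remainders≡m : m % n ℕ.+ k ℕ.* n % n ≡ m
    remainders≡m = trans (cong₂ ℕ._+_ (m<n⇒m%n≡m m<n) (m*n%n≡0 k n)) (ℕ.+-identityʳ m)

m≤2n⇒m/2+m%2≤n : ∀ m n → m ℕ.≤ 2 ℕ.* n → m / 2 ℕ.+ m % 2 ℕ.≤ n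
m≤2n⇒m/2+m%2≤n m n m≤2n with m % 2 | m%n<n m 2 | m≡m%n+[m/n]*n m 2
... | 0 | _ | m≡h*2 =
  subst (ℕ._≤ n) (sym (ℕ.+-identityʳ (m / 2)))
        (ℕ.*-cancelʳ-≤ (m / 2) n 2 (subst₂ ℕ._≤_ m≡h*2 (ℕ.*-comm 2 n) m≤2n))
... | 1 | _ | m≡1+h*2 =
  subst (ℕ._≤ n) (ℕ.+-comm 1 (m / 2))
        (ℕ.*-cancelʳ-< 2 (m / 2) n (subst₂ ℕ._≤_ m≡1+h*2 (ℕ.*-comm 2 n) m≤2n))
... | ℕ.suc (ℕ.suc _) | s≤s (s≤s ()) | _

i+∣j-i∣≡j : ∀ {i j} → i ≤ j → i + + ∣ j - i ∣ ≡ j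
i+∣j-i∣≡j {i} {j} i≤j = begin
  i + + ∣ j - i ∣ ≡⟨ cong (λ x → i + x) (ℤ.0≤i⇒+∣i∣≡i (ℤ.i≤j⇒0≤j-i i≤j)) ⟩
  i + (j - i)     ≡⟨ cancel i j ⟩
  j               ∎
  where
  open ≡-Reasoning
  cancel : ∀ i j → i + (j - i) ≡ j
  cancel = ℤ-Solver.solve-∀

∣i+n-i∣≡n : ∀ i n → ∣ i + + n - i ∣ ≡ n
∣i+n-i∣≡n i n = cong ∣_∣ (cancel i (+ n))
  where
  cancel : ∀ i j → i + j - i ≡ j
  cancel = ℤ-Solver.solve-∀

2*-cancel-≤ : ∀ {i j} → + 2 * i ≤ + 2 * j → i ≤ j
2*-cancel-≤ {i} {j} = ℤ.*-cancelˡ-≤-pos i j (+ 2)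

2*-mono-≤ : ∀ {i j} → i ≤ j → + 2 * i ≤ + 2 * j
2*-mono-≤ = ℤ.*-monoˡ-≤-nonNeg (+ 2)

record Gaps : Set where
  constructor gaps
  field
    e q r k t f : ℕ
    r≤2k : r ℕ.≤ 2 ℕ.* k

gaps-≡ : ∀ {e q r k t f e′ q′ r′ k′ t′ f′ r≤2k r′≤2k′} →
         e ≡ e′ → q ≡ q′ → r ≡ r′ → k ≡ k′ → t ≡ t′ → f ≡ f′ →
         gaps e q r k t f r≤2k ≡ gaps e′ q′ r′ k′ t′ f′ r′≤2k′
gaps-≡ {r≤2k = r≤2k} {r′≤2k′} refl refl refl refl refl refl =
  cong (gaps _ _ _ _ _ _) (ℕ.≤-irrelevant r≤2k r′≤2k′)

pat-≡ : ∀ {a b c d e f a′ b′ c′ d′ e′ f′ h₁ h₂ h₃ h₄ h₅ h₆ h₁′ h₂′ h₃′ h₄′ h₅′ h₆′} →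
        a ≡ a′ → b ≡ b′ → c ≡ c′ → d ≡ d′ → e ≡ e′ → f ≡ f′ →
        pat a b c d e f h₁ h₂ h₃ h₄ h₅ h₆ ≡ pat a′ b′ c′ d′ e′ f′ h₁′ h₂′ h₃′ h₄′ h₅′ h₆′
pat-≡ {h₁ = h₁} {h₂} {h₃} {h₄} {h₅} {h₆} {h₁′} {h₂′} {h₃′} {h₄′} {h₅′} {h₆′}
      refl refl refl refl refl refl
  rewrite ℤ.≤-irrelevant h₁ h₁′ | ℤ.≤-irrelevant h₂ h₂′ | ℤ.≤-irrelevant h₃ h₃′
        | ℤ.≤-irrelevant h₄ h₄′ | ℤ.≤-irrelevant h₅ h₅′ | ℤ.≤-irrelevant h₆ h₆′ = refl

toGaps : Pattern → Gaps
toGaps (pat a b c d e f _ h₂ h₃ _ _ _) =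
  gaps (∣ e ∣) (∣ d - e ∣) (∣ c - + 2 * d ∣) (∣ b - d ∣) (∣ a - b ∣) (∣ f ∣) (ℤ.drop‿+≤+ r≤2k)
  where
  d≤b : d ≤ b
  d≤b = 2*-cancel-≤ (ℤ.≤-trans h₃ h₂)
  r≤2k : + ∣ c - + 2 * d ∣ ≤ + (2 ℕ.* ∣ b - d ∣)
  r≤2k = begin
    + ∣ c - + 2 * d ∣     ≡⟨ ℤ.0≤i⇒+∣i∣≡i (ℤ.i≤j⇒0≤j-i h₃) ⟩
    c - + 2 * d           ≤⟨ ℤ.+-monoˡ-≤ (ℤ.- (+ 2 * d)) h₂ ⟩
    + 2 * b - + 2 * d     ≡⟨ factor b d ⟩
    + 2 * (b - d)         ≡⟨ cong (+ 2 *_) (sym (ℤ.0≤i⇒+∣i∣≡i (ℤ.i≤j⇒0≤j-i d≤b))) ⟩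
    + 2 * + ∣ b - d ∣     ≡⟨ ℤ.pos-* 2 ∣ b - d ∣ ⟨
    + (2 ℕ.* ∣ b - d ∣)   ∎
    where
    open ℤ.≤-Reasoning
    factor : ∀ b d → + 2 * b - + 2 * d ≡ + 2 * (b - d)
    factor = ℤ-Solver.solve-∀

fromGaps : Gaps → Pattern
fromGaps (gaps e q r k t f r≤2k) =
  pat a b c d (+ e) (+ f) (2*-mono-≤ (ℤ.i≤i+j b (+ t))) c≤2b (ℤ.i≤i+j (+ 2 * d) (+ r))
      (2*-mono-≤ (ℤ.i≤i+j (+ e) (+ q))) (2*-mono-≤ {j = + e} (+≤+ z≤n)) (+≤+ z≤n)
  where
  d = + e + + q
  b = d + + k
  a = b + + t
  c = + 2 * d + + r
  c≤2b : c ≤ + 2 * b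
  c≤2b = begin
    + 2 * d + + r           ≤⟨ ℤ.+-monoʳ-≤ (+ 2 * d) (+≤+ r≤2k) ⟩
    + 2 * d + + (2 ℕ.* k)   ≡⟨ cong (λ x → + 2 * d + x) (ℤ.pos-* 2 k) ⟩
    + 2 * d + + 2 * + k     ≡⟨ ℤ.*-distribˡ-+ (+ 2) d (+ k) ⟨
    + 2 * b                 ∎
    where open ℤ.≤-Reasoning

toGaps∘fromGaps : ∀ g → toGaps (fromGaps g) ≡ g
toGaps∘fromGaps (gaps e q r k t f _) =
  gaps-≡ refl (∣i+n-i∣≡n (+ e) q) (∣i+n-i∣≡n (+ 2 * d) r) (∣i+n-i∣≡n d k)
         (∣i+n-i∣≡n (d + + k) t) refl
  where d = + e + + q

fromGaps∘toGaps : ∀ π → fromGaps (toGaps π) ≡ π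
fromGaps∘toGaps (pat a b c d e f h₁ h₂ h₃ h₄ h₅ h₆) = pat-≡ a′≡a b′≡b c′≡c d′≡d e′≡e f′≡f
  where
  e′≡e : + ∣ e ∣ ≡ e
  e′≡e = ℤ.0≤i⇒+∣i∣≡i (2*-cancel-≤ h₅)
  d′≡d : + ∣ e ∣ + + ∣ d - e ∣ ≡ d
  d′≡d = trans (cong (_+ + ∣ d - e ∣) e′≡e) (i+∣j-i∣≡j (2*-cancel-≤ h₄))
  b′≡b : + ∣ e ∣ + + ∣ d - e ∣ + + ∣ b - d ∣ ≡ b
  b′≡b = trans (cong (_+ + ∣ b - d ∣) d′≡d) (i+∣j-i∣≡j (2*-cancel-≤ (ℤ.≤-trans h₃ h₂)))
  a′≡a : + ∣ e ∣ + + ∣ d - e ∣ + + ∣ b - d ∣ + + ∣ a - b ∣ ≡ a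
  a′≡a = trans (cong (_+ + ∣ a - b ∣) b′≡b) (i+∣j-i∣≡j (2*-cancel-≤ h₁))
  c′≡c : + 2 * (+ ∣ e ∣ + + ∣ d - e ∣) + + ∣ c - + 2 * d ∣ ≡ c
  c′≡c = trans (cong (λ x → + 2 * x + + ∣ c - + 2 * d ∣) d′≡d) (i+∣j-i∣≡j h₃)
  f′≡f : + ∣ f ∣ ≡ f
  f′≡f = ℤ.0≤i⇒+∣i∣≡i h₆

pattern↔gaps : Pattern ↔ Gaps
pattern↔gaps = mk↔ₛ′ toGaps fromGaps toGaps∘fromGaps fromGaps∘toGaps

pattern α₁₀ = zero
pattern α₀₁ = suc zero
pattern α₁₁ = suc (suc zero)
pattern α₂₁ = suc (suc (suc zero))
pattern α₃₁ = suc (suc (suc (suc zero)))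
pattern α₃₂ = suc (suc (suc (suc (suc zero))))

toPartition : Gaps → VectorPartition
toPartition (gaps e q r k t f _) α₁₀ = t
toPartition (gaps e q r k t f _) α₀₁ = f
toPartition (gaps e q r k t f _) α₁₁ = k ∸ (r / 2 ℕ.+ r % 2)
toPartition (gaps e q r k t f _) α₂₁ = r % 2 ℕ.+ e ℕ.* 2
toPartition (gaps e q r k t f _) α₃₁ = r / 2
toPartition (gaps e q r k t f _) α₃₂ = q

fromPartition : VectorPartition → Gaps
fromPartition ξ =
  gaps (ξ α₂₁ / 2) (ξ α₃₂) (ρ ℕ.+ ξ α₃₁ ℕ.* 2) (ξ α₃₁ ℕ.+ ρ ℕ.+ ξ α₁₁) (ξ α₁₀) (ξ α₀₁)
       (r≤2k ρ (ξ α₃₁) (ξ α₁₁))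
  where
  ρ = ξ α₂₁ % 2
  r≤2k : ∀ ρ h s → ρ ℕ.+ h ℕ.* 2 ℕ.≤ 2 ℕ.* (h ℕ.+ ρ ℕ.+ s)
  r≤2k ρ h s = subst (ρ ℕ.+ h ℕ.* 2 ℕ.≤_) (expand ρ h s) (ℕ.m≤m+n (ρ ℕ.+ h ℕ.* 2) (ρ ℕ.+ 2 ℕ.* s))
    where
    expand : ∀ ρ h s → ρ ℕ.+ h ℕ.* 2 ℕ.+ (ρ ℕ.+ 2 ℕ.* s) ≡ 2 ℕ.* (h ℕ.+ ρ ℕ.+ s)
    expand = ℕ-Solver.solve-∀

toPartition∘fromPartition : ∀ ξ α → toPartition (fromPartition ξ) α ≡ ξ α
toPartition∘fromPartition ξ α₁₀ = refl
toPartition∘fromPartition ξ α₀₁ = refl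
toPartition∘fromPartition ξ α₁₁ =
  trans (cong (ξ α₃₁ ℕ.+ ξ α₂₁ % 2 ℕ.+ ξ α₁₁ ∸_)
              (cong₂ ℕ._+_ ([m+kn]/n≡k (ξ α₃₁) 2 ρ<2) ([m+kn]%n≡m (ξ α₃₁) 2 ρ<2)))
        (ℕ.m+n∸m≡n (ξ α₃₁ ℕ.+ ξ α₂₁ % 2) (ξ α₁₁))
  where ρ<2 = m%n<n (ξ α₂₁) 2
toPartition∘fromPartition ξ α₂₁ =
  trans (cong (ℕ._+ ξ α₂₁ / 2 ℕ.* 2) ([m+kn]%n≡m (ξ α₃₁) 2 (m%n<n (ξ α₂₁) 2)))
        (sym (m≡m%n+[m/n]*n (ξ α₂₁) 2))
toPartition∘fromPartition ξ α₃₁ = [m+kn]/n≡k (ξ α₃₁) 2 (m%n<n (ξ α₂₁) 2)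
toPartition∘fromPartition ξ α₃₂ = refl

fromPartition∘toPartition : ∀ g → fromPartition (toPartition g) ≡ g
fromPartition∘toPartition (gaps e q r k t f r≤2k) =
  gaps-≡ ([m+kn]/n≡k e 2 ρ<2) refl
         (trans (cong (ℕ._+ r / 2 ℕ.* 2) parity) (sym (m≡m%n+[m/n]*n r 2)))
         (trans (cong (λ x → r / 2 ℕ.+ x ℕ.+ (k ∸ (r / 2 ℕ.+ r % 2))) parity)
                (ℕ.m+[n∸m]≡n (m≤2n⇒m/2+m%2≤n r k r≤2k)))
         refl refl
  where
  ρ<2 = m%n<n r 2
  parity : (r % 2 ℕ.+ e ℕ.* 2) % 2 ≡ r % 2
  parity = [m+kn]%n≡m e 2 ρ<2

fromPartition-cong : ∀ {ξ ξ′} → (∀ α → ξ α ≡ ξ′ α) → fromPartition ξ ≡ fromPartition ξ′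
fromPartition-cong ξ≗ξ′
  rewrite ξ≗ξ′ α₁₀ | ξ≗ξ′ α₀₁ | ξ≗ξ′ α₁₁ | ξ≗ξ′ α₂₁ | ξ≗ξ′ α₃₁ | ξ≗ξ′ α₃₂ = refl

gaps↔partitions : Inverse (setoid Gaps) (PosRoot →-setoid ℕ)
gaps↔partitions = record
  { to        = toPartition
  ; from      = fromPartition
  ; to-cong   = λ { refl α → refl }
  ; from-cong = fromPartition-cong
  ; inverse   = (λ { refl → toPartition∘fromPartition _ })
              , (λ {g} ξ≗ → trans (fromPartition-cong ξ≗) (fromPartition∘toPartition g))
  }

-- The two sides are weightV ξ and weightP (fromGaps (fromPartition ξ)) unfolded, with
-- x₂₁ = ρ + 2h the decomposition of the multiplicity of 2α_s + α_l.
weight-identity : ∀ x₁₀ x₀₁ x₁₁ x₂₁ x₃₁ x₃₂ h ρ {r : ℤ} →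
  x₂₁ ≡ ρ + h * + 2 → r ≡ ρ + x₃₁ * + 2 →
  ( x₁₀ * + 1 + (x₀₁ * + 0 + (x₁₁ * + 1 + (x₂₁ * + 2 + (x₃₁ * + 3 + (x₃₂ * + 3 + 0ℤ)))))
  , x₁₀ * + 0 + (x₀₁ * + 1 + (x₁₁ * + 1 + (x₂₁ * + 1 + (x₃₁ * + 1 + (x₃₂ * + 2 + 0ℤ))))) )
  ≡ ( h + x₃₂ + (x₃₁ + ρ + x₁₁) + x₁₀ + (+ 2 * (h + x₃₂) + r) + h
    , h + x₃₂ + (x₃₁ + ρ + x₁₁) + (h + x₃₂) + x₀₁ )
weight-identity x₁₀ x₀₁ x₁₁ _ x₃₁ x₃₂ h ρ refl refl =
  cong₂ _,_ (short x₁₀ x₀₁ x₁₁ x₃₁ x₃₂ h ρ) (long x₁₀ x₀₁ x₁₁ x₃₁ x₃₂ h ρ)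
  where
  short : ∀ x₁₀ x₀₁ x₁₁ x₃₁ x₃₂ h ρ →
    x₁₀ * + 1 + (x₀₁ * + 0 + (x₁₁ * + 1 + ((ρ + h * + 2) * + 2 + (x₃₁ * + 3 + (x₃₂ * + 3 + 0ℤ)))))
    ≡ h + x₃₂ + (x₃₁ + ρ + x₁₁) + x₁₀ + (+ 2 * (h + x₃₂) + (ρ + x₃₁ * + 2)) + h
  short = ℤ-Solver.solve-∀
  long : ∀ x₁₀ x₀₁ x₁₁ x₃₁ x₃₂ h ρ →
    x₁₀ * + 0 + (x₀₁ * + 1 + (x₁₁ * + 1 + ((ρ + h * + 2) * + 1 + (x₃₁ * + 1 + (x₃₂ * + 2 + 0ℤ)))))
    ≡ h + x₃₂ + (x₃₁ + ρ + x₁₁) + (h + x₃₂) + x₀₁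
  long = ℤ-Solver.solve-∀

weightV≡weightP∘fromGaps∘fromPartition : ∀ ξ → weightV ξ ≡ weightP (fromGaps (fromPartition ξ))
weightV≡weightP∘fromGaps∘fromPartition ξ =
  weight-identity (x α₁₀) (x α₀₁) (x α₁₁) (x α₂₁) (x α₃₁) (x α₃₂) (+ h) (+ ρ) x₂₁≡ρ+h*2 r≡ρ+x₃₁*2
  where
  x : PosRoot → ℤ
  x α = + ξ α
  h = ξ α₂₁ / 2
  ρ = ξ α₂₁ % 2
  x₂₁≡ρ+h*2 : + ξ α₂₁ ≡ + ρ + + h * + 2
  x₂₁≡ρ+h*2 = trans (cong +_ (m≡m%n+[m/n]*n (ξ α₂₁) 2))
                    (trans (ℤ.pos-+ ρ (h ℕ.* 2)) (cong (_+_ (+ ρ)) (ℤ.pos-* h 2)))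
  r≡ρ+x₃₁*2 : + (ρ ℕ.+ ξ α₃₁ ℕ.* 2) ≡ + ρ + + ξ α₃₁ * + 2
  r≡ρ+x₃₁*2 = trans (ℤ.pos-+ ρ (ξ α₃₁ ℕ.* 2)) (cong (_+_ (+ ρ)) (ℤ.pos-* (ξ α₃₁) 2))

pattern↔partitions : Inverse (setoid Pattern) (PosRoot →-setoid ℕ)
pattern↔partitions = inverse pattern↔gaps gaps↔partitions

lemma5p4 : Σ (Bijection (setoid Pattern) (PosRoot →-setoid ℕ))
               (λ φ → ∀ (π : Pattern) → weightV (Bijection.to φ π) ≡ weightP π)
lemma5p4 = Inverse⇒Bijection pattern↔partitions , weight-preserved
  where
  open Inverse pattern↔partitions using (to; strictlyInverseʳ)
  weight-preserved : ∀ π → weightV (to π) ≡ weightP π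
  weight-preserved π = begin
    weightV (to π)                                ≡⟨ weightV≡weightP∘fromGaps∘fromPartition (to π) ⟩
    weightP (fromGaps (fromPartition (to π)))     ≡⟨ cong weightP (strictlyInverseʳ π) ⟩
    weightP π                                     ∎
    where open ≡-Reasoning
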